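{- Let $n\ge1$ and $\pi\in\mathcal I^C_{2n}(321)$. Then $$\mathrm{Des}^+(\pi)=\{i\in [n]: i\in E_{\pi}\text{ and } i+1\notin E_{\pi}\}.$$
   Context: $[n]=\{1,\dots,n\}$. A permutation $\pi\in\mathcal S_m$ is centrosymmetric if $\pi(i)+\pi(m+1-i)=m+1$ for all $1\le i\le m$. $\mathcal I^C_m(321)$ denotes the set of centrosymmetric involutions in $\mathcal S_m$ that avoid the pattern $321$. For $\pi\in\mathcal I^C_{2n}(321)$: $\mathrm{Des}^+(\pi)=\{i\in[n]:\pi(i)>\pi(i+1)\}$, and $E_\pi=\{i\in[n]:\pi(i)>i\}$ (the excedances of $\pi$ lying in $[n]$). -}

module Defs where

open import Data.Nat using (ℕ; zero; suc; _+_; _*_; _∸_; _<_; _≤_; _>_; _<?_)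
open import Data.Fin using (Fin; toℕ; fromℕ<; opposite)
open import Data.Fin.Permutation using (Permutation′; _⟨$⟩ʳ_)
open import Data.Product using (_×_; Σ-syntax)
open import Relation.Binary.PropositionalEquality using (_≡_)
open import Relation.Nullary using (¬_; yes; no)

-- A permutation of [m] is represented by a stdlib permutation of Fin m
-- (0-based: position i ∈ [m] corresponds to Fin element i-1).

-- 1-based value: app π i = π(i) for 1 ≤ i ≤ m (value returned is 1-based).
-- Outside [m] the value is irrelevant (we return i itself).
app : ∀ {m} → Permutation′ m → ℕ → ℕ
app {m} π zero = zero
app {m} π (suc k) with k <? m
... | yes p = suc (toℕ (π ⟨$⟩ʳ fromℕ< p))
... | no _  = suc k

IsInvolution : ∀ {m} → Permutation′ m → Set
IsInvolution π = ∀ i → π ⟨$⟩ʳ (π ⟨$⟩ʳ i) ≡ i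

-- centrosymmetric: π(i) + π(m+1-i) = m+1 (1-based);
-- in 0-based Fin terms: π(i) + π(m-1-i) = m-1, with opposite i = m-1-i.
IsCentrosymmetric : ∀ {m} → Permutation′ m → Set
IsCentrosymmetric {m} π =
  ∀ i → toℕ (π ⟨$⟩ʳ i) + toℕ (π ⟨$⟩ʳ opposite i) ≡ m ∸ 1

Avoids321 : ∀ {m} → Permutation′ m → Set
Avoids321 {m} π =
  ¬ (Σ[ i ∈ Fin m ] Σ[ j ∈ Fin m ] Σ[ k ∈ Fin m ]
       (toℕ i < toℕ j × toℕ j < toℕ k ×
        toℕ (π ⟨$⟩ʳ i) > toℕ (π ⟨$⟩ʳ j) × toℕ (π ⟨$⟩ʳ j) > toℕ (π ⟨$⟩ʳ k)))

InIC321 : ∀ {m} → Permutation′ m → Set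
InIC321 π = IsInvolution π × IsCentrosymmetric π × Avoids321 π

InDesPlus : (n : ℕ) → Permutation′ (2 * n) → ℕ → Set
InDesPlus n π i = (1 ≤ i × i ≤ n) × app π i > app π (suc i)

InE : (n : ℕ) → Permutation′ (2 * n) → ℕ → Set
InE n π i = (1 ≤ i × i ≤ n) × app π i > i

module Submission where

-- For a 321-avoiding involution π and positions x < y with π(y) < π(x), y cannot be an
-- excedance, since (y, π(y), π(x)) would be a 321 pattern, and x must be one, since
-- otherwise (π(y), π(x), x), or (π(y), x, y) when π(x) = x, would be a 321 pattern.
-- Conversely, if x is an excedance and x + 1 is not, then π(x + 1) ≤ x + 1 ≤ π(x), and
-- injectivity excludes equality. This settles every i < n. At i = n the index n + 1 lies
-- outside [n], and centrosymmetry gives π(n) + π(n + 1) = 2n + 1, so π(n) > π(n + 1)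
-- exactly when π(n) > n.

open import Defs
open import Data.Nat
  using (ℕ; zero; suc; _+_; _*_; _∸_; _≤_; _<_; z≤n; s≤s; s≤s⁻¹; s<s; s<s⁻¹; _<?_; _≤?_)
open import Data.Nat.Properties
open import Data.Fin using (Fin; toℕ; fromℕ<; opposite)
open import Data.Fin.Properties using (toℕ-injective; toℕ-fromℕ<; fromℕ<-toℕ; toℕ<n; opposite-prop)
open import Data.Fin.Permutation using (Permutation′; _⟨$⟩ʳ_)
open import Data.Product using (_×_; _,_; proj₁; proj₂)
open import Data.Product.Function.NonDependent.Propositional using (_×-⇔_)
open import Data.Sum using (inj₁; inj₂)
open import Data.Empty using (⊥; ⊥-elim)
open import Function.Base using (_∘_)
open import Function.Bundles using (_⇔_; mk⇔; Injection; Equivalence)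
open import Function.Properties.Equivalence
  using () renaming (trans to ⇔-trans; sym to ⇔-sym)
open import Function.Properties.Inverse using (↔⇒↣)
open import Function.Related.TypeIsomorphisms using (¬-cong-⇔)
open import Function.Construct.Identity using (⇔-id)
open import Relation.Nullary using (¬_; yes; no)
open import Relation.Binary.PropositionalEquality

-- 0-based values of π, whereas `app` is 1-based.
π̂ : ∀ {m} → Permutation′ m → Fin m → ℕ
π̂ π z = toℕ (π ⟨$⟩ʳ z)

π̂-injective : ∀ {m} (π : Permutation′ m) {x y} → π̂ π x ≡ π̂ π y → x ≡ y
π̂-injective π = Injection.injective (↔⇒↣ π) ∘ toℕ-injective

app-toℕ : ∀ {m} (π : Permutation′ m) (z : Fin m) → app π (suc (toℕ z)) ≡ suc (π̂ π z)
app-toℕ {m} π z with toℕ z <? m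
... | yes z<m = cong (suc ∘ π̂ π) (fromℕ<-toℕ z z<m)
... | no z≮m = ⊥-elim (z≮m (toℕ<n z))

app-<⇔ : ∀ {m} (π : Permutation′ m) (x y : Fin m) →
         app π (suc (toℕ y)) < app π (suc (toℕ x)) ⇔ π̂ π y < π̂ π x
app-<⇔ π x y rewrite app-toℕ π x | app-toℕ π y = mk⇔ s<s⁻¹ s<s

app-excedance⇔ : ∀ {m} (π : Permutation′ m) (z : Fin m) →
                 suc (toℕ z) < app π (suc (toℕ z)) ⇔ toℕ z < π̂ π z
app-excedance⇔ π z rewrite app-toℕ π z = mk⇔ s<s⁻¹ s<s

module Involution321 {m} {π : Permutation′ m} (inv : IsInvolution π) (avoid : Avoids321 π) where

  π̂-involutive : ∀ z → π̂ π (π ⟨$⟩ʳ z) ≡ toℕ z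
  π̂-involutive z = cong toℕ (inv z)

  no-321 : ∀ {i j k} → toℕ i < toℕ j → toℕ j < toℕ k → π̂ π j < π̂ π i → π̂ π k < π̂ π j → ⊥
  no-321 {i} {j} {k} i<j j<k πj<πi πk<πj = avoid (i , j , k , i<j , j<k , πj<πi , πk<πj)

  <-under-π : ∀ {x y} → toℕ x < toℕ y → π̂ π (π ⟨$⟩ʳ x) < π̂ π (π ⟨$⟩ʳ y)
  <-under-π {x} {y} = subst₂ _<_ (sym (π̂-involutive x)) (sym (π̂-involutive y))

  descent⇒¬excedance : ∀ {x y} → toℕ x < toℕ y → π̂ π y < π̂ π x → ¬ toℕ y < π̂ π y
  descent⇒¬excedance {x} {y} x<y πy<πx y<πy =
    no-321 y<πy πy<πx (subst (_< π̂ π y) (sym (π̂-involutive y)) y<πy) (<-under-π x<y)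

  descent⇒excedance : ∀ {x y} → toℕ x < toℕ y → π̂ π y < π̂ π x → toℕ x < π̂ π x
  descent⇒excedance {x} {y} x<y πy<πx = ≰⇒> πx≰x
    where
    πx≰x : ¬ π̂ π x ≤ toℕ x
    πx≰x πx≤x with m≤n⇒m<n∨m≡n πx≤x
    ... | inj₁ πx<x = no-321 πy<πx πx<x (<-under-π x<y)
                             (subst (π̂ π x <_) (sym (π̂-involutive x)) πx<x)
    ... | inj₂ πx≡x = no-321 (subst (π̂ π y <_) πx≡x πy<πx) x<y
                             (subst₂ _<_ (sym πx≡x) (sym (π̂-involutive y)) x<y) πy<πx

  excedance-boundary⇒descent : ∀ {x y} → toℕ y ≡ suc (toℕ x) →
                               toℕ x < π̂ π x → ¬ toℕ y < π̂ π y → π̂ π y < π̂ π x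
  excedance-boundary⇒descent {x} {y} y≡1+x x<πx y≮πy = ≤∧≢⇒< πy≤πx πy≢πx
    where
    πy≤πx : π̂ π y ≤ π̂ π x
    πy≤πx = ≤-trans (≮⇒≥ y≮πy) (subst (_≤ π̂ π x) (sym y≡1+x) x<πx)
    πy≢πx : π̂ π y ≢ π̂ π x
    πy≢πx πy≡πx = 1+n≢n (trans (sym y≡1+x) (cong toℕ (π̂-injective π πy≡πx)))

  adjacent-descent⇔ : ∀ {x y} → toℕ y ≡ suc (toℕ x) →
                      π̂ π y < π̂ π x ⇔ (toℕ x < π̂ π x × ¬ toℕ y < π̂ π y)
  adjacent-descent⇔ {x} {y} y≡1+x = mk⇔
    (λ d → descent⇒excedance x<y d , descent⇒¬excedance x<y d)
    (λ (x<πx , y≮πy) → excedance-boundary⇒descent y≡1+x x<πx y≮πy)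
    where
    x<y : toℕ x < toℕ y
    x<y = ≤-reflexive (sym y≡1+x)

  app-adjacent-descent⇔ : ∀ k → suc k < m →
    app π (suc (suc k)) < app π (suc k)
      ⇔ (suc k < app π (suc k) × ¬ suc (suc k) < app π (suc (suc k)))
  app-adjacent-descent⇔ k 1+k<m
    with fromℕ< (<-trans (n<1+n k) 1+k<m) | toℕ-fromℕ< (<-trans (n<1+n k) 1+k<m)
  ... | x | refl = subst (λ j → app π (suc j) < app π (suc (toℕ x))
                                ⇔ (suc (toℕ x) < app π (suc (toℕ x)) × ¬ suc j < app π (suc j)))
                         y≡1+x
    (⇔-trans (app-<⇔ π x y) (⇔-trans (adjacent-descent⇔ y≡1+x)
      (⇔-sym (app-excedance⇔ π x ×-⇔ ¬-cong-⇔ (app-excedance⇔ π y)))))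
    where
    y : Fin m
    y = fromℕ< 1+k<m
    y≡1+x : toℕ y ≡ suc (toℕ x)
    y≡1+x = toℕ-fromℕ< 1+k<m

app-opposite : ∀ {m} (π : Permutation′ m) → IsCentrosymmetric π →
  (z : Fin m) → app π (suc (toℕ z)) + app π (suc (toℕ (opposite z))) ≡ suc m
app-opposite {zero} π cen ()
app-opposite {suc m} π cen z = begin
  app π (suc (toℕ z)) + app π (suc (toℕ (opposite z)))
    ≡⟨ cong₂ _+_ (app-toℕ π z) (app-toℕ π (opposite z)) ⟩
  suc (π̂ π z) + suc (π̂ π (opposite z))                 ≡⟨ cong suc (+-suc (π̂ π z) _) ⟩
  suc (suc (π̂ π z + π̂ π (opposite z)))                 ≡⟨ cong (suc ∘ suc) (cen z) ⟩
  suc (suc m)                                           ∎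
  where open ≡-Reasoning

sum-odd-<⇔ : ∀ {a b n} → a + b ≡ suc (n + n) → b < a ⇔ n < a
sum-odd-<⇔ {a} {b} {n} a+b≡1+2n = mk⇔ (λ b<a → ≰⇒> (a≰n b<a)) (λ n<a → ≰⇒> (a≰b n<a))
  where
  a≰n : b < a → ¬ a ≤ n
  a≰n b<a a≤n = <-irrefl refl (<-trans (subst (n + n <_) (sym a+b≡1+2n) (n<1+n _))
                                        (<-≤-trans (+-monoʳ-< a b<a) (+-mono-≤ a≤n a≤n)))
  a≰b : n < a → ¬ a ≤ b
  a≰b n<a a≤b = <-irrefl refl (<-≤-trans (+-monoʳ-< n (n<1+n n))
                  (s≤s⁻¹ (subst (suc n + suc n ≤_) a+b≡1+2n (+-mono-≤ n<a (≤-trans n<a a≤b)))))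

centre-descent⇔ : ∀ {n} (π : Permutation′ (2 * n)) → IsCentrosymmetric π → 1 ≤ n →
  app π (suc n) < app π n ⇔ n < app π n
centre-descent⇔ {suc k} π cen _ = sum-odd-<⇔ (begin
  app π (suc k) + app π (suc (suc k))
    ≡⟨ cong₂ (λ i j → app π (suc i) + app π (suc j)) (sym x≡k) (sym opposite-x≡1+k) ⟩
  app π (suc (toℕ x)) + app π (suc (toℕ (opposite x))) ≡⟨ app-opposite π cen x ⟩
  suc (2 * suc k)                                       ≡⟨ cong (λ j → suc (suc k + j)) (+-identityʳ (suc k)) ⟩
  suc (suc k + suc k)                                   ∎)
  where
  open ≡-Reasoning
  k<2n : k < 2 * suc k
  k<2n = <-≤-trans (n<1+n k) (m≤m+n (suc k) _)
  x : Fin (2 * suc k)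
  x = fromℕ< k<2n
  x≡k : toℕ x ≡ k
  x≡k = toℕ-fromℕ< k<2n
  opposite-x≡1+k : toℕ (opposite x) ≡ suc k
  opposite-x≡1+k = begin
    toℕ (opposite x)        ≡⟨ opposite-prop x ⟩
    2 * suc k ∸ suc (toℕ x) ≡⟨ cong (λ j → 2 * suc k ∸ suc j) x≡k ⟩
    2 * suc k ∸ suc k       ≡⟨ m+n∸m≡n (suc k) (suc k + 0) ⟩
    suc k + 0               ≡⟨ +-identityʳ (suc k) ⟩
    suc k                   ∎

descent⇔excedance-boundary : ∀ {n} (π : Permutation′ (2 * n)) → InIC321 π →
  ∀ {i} → 1 ≤ i × i ≤ n → app π (suc i) < app π i ⇔ (i < app π i × ¬ InE n π (suc i))
descent⇔excedance-boundary {n} π (inv , cen , avoid) {suc k} (_ , 1+k≤n)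
  with suc (suc k) ≤? n
... | yes 2+k≤n = ⇔-trans (app-adjacent-descent⇔ k (<-≤-trans 2+k≤n (m≤m+n n _)))
                    (⇔-id _ ×-⇔ ¬-cong-⇔ (mk⇔ ((s≤s z≤n , 2+k≤n) ,_) proj₂))
  where open Involution321 inv avoid
... | no 2+k≰n = ⇔-trans (subst (λ j → app π (suc j) < app π j ⇔ j < app π j) n≡1+k
                                 (centre-descent⇔ π cen (≤-trans (s≤s z≤n) 1+k≤n)))
                   (mk⇔ (_, λ ((_ , 2+k≤n) , _) → 2+k≰n 2+k≤n) proj₁)
  where
  n≡1+k : n ≡ suc k
  n≡1+k = ≤-antisym (s≤s⁻¹ (≰⇒> 2+k≰n)) 1+k≤n

lemma3p6 : (n : ℕ) → 1 ≤ n → (π : Permutation′ (2 * n)) → InIC321 π →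
    ∀ (i : ℕ) → InDesPlus n π i ⇔ ((1 ≤ i × i ≤ n) × InE n π i × ¬ InE n π (suc i))
lemma3p6 n _ π π∈IC321 i = mk⇔
  (λ (i∈[n] , d) → let (e , ¬e′) = Equivalence.to (descent⇔ i∈[n]) d
                    in i∈[n] , (i∈[n] , e) , ¬e′)
  (λ (i∈[n] , (_ , e) , ¬e′) → i∈[n] , Equivalence.from (descent⇔ i∈[n]) (e , ¬e′))
  where
  descent⇔ : 1 ≤ i × i ≤ n → app π (suc i) < app π i ⇔ (i < app π i × ¬ InE n π (suc i))
  descent⇔ = descent⇔excedance-boundary π π∈IC321
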